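{- Let $\alpha_1$ be irrational with continued fraction expansion $[a_0;a_1,a_2,\ldots]$ and convergent denominators $(q_n)_{n\ge -2}$. Let $k<k'$ be indices with $k\ge0$ and $k'\ge 1$. Set $b:=\gcd(q_k,q_{k'-2})$, $c:=q_k/b$, $d:=\gcd(c,q_{k'-3})$ and $e:=c/d$. If $\gcd(d,a_{k'-1})=1$ and $e\mid a_{k'-1}$, then $\gcd(q_{k'-1},q_k)=1$.
   Context: Convergent denominators: $q_{ -2}=1$, $q_{ -1}=0$, $q_n=a_nq_{n-1}+q_{n-2}$ for $n\ge 0$. -}

module Defs where

open import Data.Nat using (ℕ; zero; suc)
open import Data.Integer using (ℤ; _+_; _*_; 0ℤ; 1ℤ)

-- Shifted convergent denominators: qs a m = q_{m-2}, i.e.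
-- qs a 0 = q_{-2} = 1, qs a 1 = q_{-1} = 0,
-- qs a (n+2) = q_n = a_n * q_{n-1} + q_{n-2}.
qs : (ℕ → ℤ) → ℕ → ℤ
qs a zero = 1ℤ
qs a (suc zero) = 0ℤ
qs a (suc (suc n)) = a n * qs a (suc n) + qs a n

-- a is the sequence of partial quotients of an irrational number:
-- an infinite sequence with a_0 ∈ ℤ and a_n ≥ 1 for n ≥ 1.
IsCFExpansion : (ℕ → ℤ) → Set
IsCFExpansion a = ∀ n → 1ℤ Data.Integer.≤ a (suc n)

{-# OPTIONS --safe #-}

-- Let x be a common divisor of q_{k'-1} and q_k. Consecutive denominators are
-- coprime (for any integer partial quotients), so x is coprime to q_{k'-2} and
-- hence to b; as q_k = c b, x divides c. A common divisor of x and d divides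
-- q_{k'-1} = a_{k'-1} q_{k'-2} + q_{k'-3} and q_{k'-3}, hence a_{k'-1}; so x is
-- coprime to d. Then x divides e, hence a_{k'-1}, hence q_{k'-3}, hence
-- gcd(c, q_{k'-3}) = d, and x = 1.

module Submission where

open import Defs
open import Data.Nat using (ℕ; zero; suc; _+_; _<_; _≤_; _∸_)
open import Data.Integer using (ℤ; +_; _*_; 1ℤ)
open import Data.Integer.GCD using (gcd)
open import Data.Integer.Divisibility using (_∣_)
open import Relation.Binary.PropositionalEquality using (_≡_)

import Data.Integer as ℤ
open import Data.Integer.Properties using (*-comm; +-injective)
open import Data.Integer.GCD using (gcd[i,j]∣j; gcd-greatest)
open import Data.Integer.Coprimality using (Coprime; coprime-divisor)
import Data.Integer.Divisibility.Signed as Signed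
import Data.Nat.Divisibility as ℕ
open import Data.Nat.Coprimality using (coprime⇒gcd≡1; gcd≡1⇒coprime)
open import Data.Product using (_,_)
open import Relation.Binary.PropositionalEquality using (refl; cong; subst)

private
  variable
    i j k m n : ℤ

∣m+n∣m⇒∣n : k ∣ m ℤ.+ n → k ∣ m → k ∣ n
∣m+n∣m⇒∣n {k} {m} {n} k∣m+n k∣m = Signed.∣⇒∣ᵤ
  (Signed.∣m+n∣m⇒∣n {k} {m} {n} (Signed.∣ᵤ⇒∣ {k} {m ℤ.+ n} k∣m+n) (Signed.∣ᵤ⇒∣ {k} {m} k∣m))

∣m+n∣n⇒∣m : k ∣ m ℤ.+ n → k ∣ n → k ∣ m
∣m+n∣n⇒∣m {k} {m} {n} k∣m+n k∣n = Signed.∣⇒∣ᵤ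
  (Signed.∣m+n∣n⇒∣m {k} {m} {n} (Signed.∣ᵤ⇒∣ {k} {m ℤ.+ n} k∣m+n) (Signed.∣ᵤ⇒∣ {k} {n} k∣n))

∣m⇒∣m*n : ∀ n → k ∣ m → k ∣ m * n
∣m⇒∣m*n {k} {m} n k∣m = Signed.∣⇒∣ᵤ (Signed.∣m⇒∣m*n n (Signed.∣ᵤ⇒∣ {k} {m} k∣m))

∣n⇒∣m*n : ∀ m → k ∣ n → k ∣ m * n
∣n⇒∣m*n {k} {n} m k∣n = Signed.∣⇒∣ᵤ (Signed.∣n⇒∣m*n m (Signed.∣ᵤ⇒∣ {k} {n} k∣n))

coprime⇒∣1 : Coprime i j → k ∣ i → k ∣ j → k ∣ 1ℤ
coprime⇒∣1 coprime k∣i k∣j = ℕ.∣-reflexive (coprime (k∣i , k∣j))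

∣1⇒coprime : (∀ {k} → k ∣ i → k ∣ j → k ∣ 1ℤ) → Coprime i j
∣1⇒coprime common⇒unit (d∣i , d∣j) = ℕ.∣1⇒≡1 (common⇒unit {+ _} d∣i d∣j)

coprime-∣ˡ : Coprime i j → k ∣ i → Coprime k j
coprime-∣ˡ coprime k∣i (d∣k , d∣j) = coprime (ℕ.∣-trans d∣k k∣i , d∣j)

coprime-∣ʳ : Coprime i j → k ∣ j → Coprime i k
coprime-∣ʳ coprime k∣j (d∣i , d∣k) = coprime (d∣i , ℕ.∣-trans d∣k k∣j)

coprime-*+ : ∀ i → Coprime j k → Coprime (i * j ℤ.+ k) j
coprime-*+ {j} {k} i coprime (d∣i*j+k , d∣j) =
  coprime (d∣j , ∣m+n∣m⇒∣n {+ _} {i * j} d∣i*j+k (∣n⇒∣m*n {+ _} i d∣j))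

qs-coprime : ∀ a n → Coprime (qs a (suc n)) (qs a n)
qs-coprime a zero (_ , d∣1) = ℕ.∣1⇒≡1 d∣1
qs-coprime a (suc n) = coprime-*+ (a n) (qs-coprime a n)

common-divisor⇒∣multiplier : ∀ A {p q r} → p ≡ A * q ℤ.+ r → Coprime p q →
  k ∣ p → k ∣ r → k ∣ A
common-divisor⇒∣multiplier {k} A {p} {q} {r} refl coprime k∣p k∣r =
  coprime-divisor k q A (coprime-∣ˡ {p} {q} {k} coprime k∣p)
    (subst (k ∣_) (*-comm A q) (∣m+n∣n⇒∣m {k} {A * q} k∣p k∣r))

coprime-by-factorisation : ∀ A {p q r s} b c e →
  p ≡ A * q ℤ.+ r → Coprime p q →
  s ≡ c * b → b ∣ q →
  c ≡ e * gcd c r → Coprime (gcd c r) A → e ∣ A →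
  Coprime p s
coprime-by-factorisation A {p} {q} {r} {s} b c e p≡ p⊥q refl b∣q c≡ d⊥A e∣A =
  ∣1⇒coprime {p} {s} λ {x} → common-divisor-∣1 {x}
  where
  d = gcd c r

  common-divisor-∣1 : ∀ {x} → x ∣ p → x ∣ s → x ∣ 1ℤ
  common-divisor-∣1 {x} x∣p x∣s = coprime⇒∣1 {x} {d} {x} x⊥d ℕ.∣-refl x∣d
    where
    x∣c : x ∣ c
    x∣c = coprime-divisor x b c
      (coprime-∣ˡ {p} {b} {x} (coprime-∣ʳ {p} {q} {b} p⊥q b∣q) x∣p)
      (subst (x ∣_) (*-comm c b) x∣s)

    x⊥d : Coprime x d
    x⊥d = ∣1⇒coprime {x} {d} λ {y} y∣x y∣d → coprime⇒∣1 {d} {A} {y} d⊥A y∣d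
      (common-divisor⇒∣multiplier {y} A p≡ p⊥q
        (ℕ.∣-trans y∣x x∣p) (ℕ.∣-trans y∣d (gcd[i,j]∣j c r)))

    x∣e : x ∣ e
    x∣e = coprime-divisor x d e x⊥d (subst (x ∣_) (*-comm e d) (subst (x ∣_) c≡ x∣c))

    x∣r : x ∣ r
    x∣r = ∣m+n∣m⇒∣n {x} {A * q} (subst (x ∣_) p≡ x∣p)
      (∣m⇒∣m*n {x} {A} q (ℕ.∣-trans x∣e e∣A))

    x∣d : x ∣ d
    x∣d = gcd-greatest {c} {r} {x} x∣c x∣r

lemma3 : (a : ℕ → ℤ) → IsCFExpansion a →
    (k k′ : ℕ) → k < k′ → 1 ≤ k′ →
    (b c d e : ℤ) →
    b ≡ gcd (qs a (k + 2)) (qs a k′) →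
    qs a (k + 2) ≡ c * b →
    d ≡ gcd c (qs a (k′ ∸ 1)) →
    c ≡ e * d →
    gcd d (a (k′ ∸ 1)) ≡ 1ℤ →
    e ∣ a (k′ ∸ 1) →
    gcd (qs a (suc k′)) (qs a (k + 2)) ≡ 1ℤ
lemma3 a _ k (suc m) _ _ b c d e refl qk≡cb refl c≡ed gcd[d,a]≡1 e∣a =
  cong +_ (coprime⇒gcd≡1
    (coprime-by-factorisation (a m) b c e refl (qs-coprime a (suc m))
      qk≡cb (gcd[i,j]∣j (qs a (k + 2)) (qs a (suc m)))
      c≡ed (gcd≡1⇒coprime (+-injective gcd[d,a]≡1)) e∣a))
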